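{- Let $m$ and $n$ be positive integers and let $j$, $k$ be non-negative integers. Then $$\frac{(n-k)(k+1)}{n}\binom{n+k}{2k}\binom{m+1}{k+1}\binom{m+k}{k+1}$$ and $$\frac{1}{k+1}\binom{n-1}{k}\binom{n+k}{k}\binom{2k}{j+k}\binom{m+k}{2k}\binom{m}{j}\binom{m+j}{j}$$ are integers.
   Context: Binomial coefficients $\binom{a}{b}$ for integers $a\ge 0$ are taken to be $0$ when $b<0$ or $b>a$. -}

module Defs where

module Submission where

open import Defs
open import Data.Nat using (ℕ; suc; _+_; _*_; _∸_; _≤_)
open import Data.Nat.Combinatorics using (_C_)
open import Data.Nat.Divisibility using (_∣_)
open import Data.Integer using (ℤ; +_; _-_) renaming (_*_ to _*ℤ_)
open import Data.Integer.Divisibility using () renaming (_∣_ to _∣ℤ_)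
open import Data.Product using (_×_)

open import Data.Nat using (zero; _!; _<_; s<s)
open import Data.Nat.Properties
open import Data.Nat.Combinatorics
  using (nCk≡n!/k![n-k]!; k![n∸k]!∣n!; k>n⇒nCk≡0; nCk+nC[k+1]≡[n+1]C[k+1])
open import Data.Nat.DivMod using (_/_; m/n*n≡m)
open import Data.Nat.Divisibility
open import Data.Nat.GCD using (gcd; gcd[m,n]∣m; gcd[m,n]∣n; gcd-greatest; c*gcd[m,n]≡gcd[cm,cn])
open import Data.Nat.Coprimality using (Coprime; coprime-divisor)
open import Data.Nat.Tactic.RingSolver using (solve-∀)
open import Algebra.Properties.CommutativeSemigroup *-commutativeSemigroup
  using (xy∙z≈xz∙y; xy∙z≈y∙xz; xy∙z≈x∙zy; x∙yz≈y∙xz)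
open import Data.Integer using (∣_∣)
import Data.Integer.Properties as ℤ
open import Data.Product using (_,_)
open import Relation.Binary.PropositionalEquality
open import Relation.Nullary using (yes; no)

-- With s = m − k one has m(m+1) = s(s+2k+1) + k(k+1); absorption and shifting identities then
-- show that k + 1 divides m(m+1)·C(m+k,2k).  Multiplying by C(2k,k) and using
-- C(m+k,2k)·C(2k,k) = C(m+k,k)·C(m,k) turns this into C(2k,k) ∣ (k+1)·C(m+1,k+1)·C(m+k,k+1),
-- while the same trinomial identity gives (n−k)·C(n+k,2k)·C(2k,k) = n·C(n+k,k)·C(n−1,k);
-- together they give the first divisibility.
--
-- For the second, C(2k,j+k)·C(m+k,2k)·C(m+j,j) = C(k,j)·C(m+k,k)·C(m+j,k+j).  Now k + 1 divides
-- m·C(m+k,k), m divides j·C(m,j) and m + j divides (k+j)·C(m+j,k+j); a common divisor of k + 1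
-- and j is coprime to k + j.  Peeling off gcds (a ∣ m·A and gcd(a,m) ∣ X give a ∣ A·X) twice
-- yields k + 1 ∣ C(m+k,k)·C(m,j)·C(m+j,k+j).

-- B a b is the binomial coefficient indexed by the two parts of a + b, so identities between
-- products of B's involve no truncated subtraction and can be checked on factorials.
B : ℕ → ℕ → ℕ
B a b = (a + b) C a

B-factorial : ∀ a b → B a b * (a ! * b !) ≡ (a + b) !
B-factorial a b = begin
  B a b * (a ! * b !)                                        ≡⟨ cong (λ c → B a b * (a ! * c !)) (m+n∸m≡n a b) ⟨
  B a b * (a ! * (a + b ∸ a) !)                              ≡⟨ cong (_* (a ! * (a + b ∸ a) !)) (nCk≡n!/k![n-k]! a≤a+b) ⟩
  (a + b) ! / (a ! * (a + b ∸ a) !) * (a ! * (a + b ∸ a) !) ≡⟨ m/n*n≡m (k![n∸k]!∣n! a≤a+b) ⟩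
  (a + b) !                                                  ∎
  where
  open ≡-Reasoning
  a≤a+b = m≤m+n a b
  instance _ = a !* (a + b ∸ a) !≢0

B-sym : ∀ a b → B a b ≡ B b a
B-sym a b = *-cancelʳ-≡ (B a b) (B b a) (a ! * b !) {{a !* b !≢0}} (begin
  B a b * (a ! * b !) ≡⟨ B-factorial a b ⟩
  (a + b) !           ≡⟨ cong _! (+-comm a b) ⟩
  (b + a) !           ≡⟨ B-factorial b a ⟨
  B b a * (b ! * a !) ≡⟨ cong (B b a *_) (*-comm (b !) (a !)) ⟩
  B b a * (a ! * b !) ∎)
  where open ≡-Reasoning

B-absorption : ∀ a b → suc (a + b) * B a b ≡ suc a * B (suc a) b
B-absorption a b = *-cancelʳ-≡ _ _ (a ! * b !) {{a !* b !≢0}} (begin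
  suc (a + b) * B a b * (a ! * b !)   ≡⟨ *-assoc (suc (a + b)) (B a b) (a ! * b !) ⟩
  suc (a + b) * (B a b * (a ! * b !)) ≡⟨ cong (suc (a + b) *_) (B-factorial a b) ⟩
  suc (a + b) !                       ≡⟨ B-factorial (suc a) b ⟨
  B (suc a) b * (suc a * a ! * b !)   ≡⟨ pull (B (suc a) b) (suc a) (a !) (b !) ⟩
  suc a * B (suc a) b * (a ! * b !)   ∎)
  where
  open ≡-Reasoning
  pull : ∀ x s p q → x * (s * p * q) ≡ s * x * (p * q)
  pull = solve-∀

B-trinomial : ∀ a b c → B (a + b) c * B a b ≡ B a (b + c) * B b c
B-trinomial a b c = *-cancelʳ-≡ _ _ (a ! * b ! * c !) {{m*n≢0 _ _ {{a !* b !≢0}} {{c !≢0}}}} (begin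
  B (a + b) c * B a b * (a ! * b ! * c !)   ≡⟨ regroupˡ (B (a + b) c) (B a b) (a !) (b !) (c !) ⟩
  B (a + b) c * (B a b * (a ! * b !) * c !) ≡⟨ cong (λ x → B (a + b) c * (x * c !)) (B-factorial a b) ⟩
  B (a + b) c * ((a + b) ! * c !)           ≡⟨ B-factorial (a + b) c ⟩
  (a + b + c) !                             ≡⟨ cong _! (+-assoc a b c) ⟩
  (a + (b + c)) !                           ≡⟨ B-factorial a (b + c) ⟨
  B a (b + c) * (a ! * (b + c) !)           ≡⟨ cong (λ x → B a (b + c) * (a ! * x)) (B-factorial b c) ⟨
  B a (b + c) * (a ! * (B b c * (b ! * c !))) ≡⟨ regroupʳ (B a (b + c)) (B b c) (a !) (b !) (c !) ⟩
  B a (b + c) * B b c * (a ! * b ! * c !)   ∎)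
  where
  open ≡-Reasoning
  regroupˡ : ∀ x y p q r → x * y * (p * q * r) ≡ x * (y * (p * q) * r)
  regroupˡ = solve-∀
  regroupʳ : ∀ x y p q r → x * (p * (y * (q * r))) ≡ x * y * (p * q * r)
  regroupʳ = solve-∀

[k+1]*[n+1]C[k+1]≡[n+1]*nCk : ∀ n k → suc k * (suc n C suc k) ≡ suc n * (n C k)
[k+1]*[n+1]C[k+1]≡[n+1]*nCk n k with k ≤? n
... | yes k≤n with b , refl ← m≤n⇒∃[o]m+o≡n k≤n = sym (B-absorption k b)
... | no k≰n = begin
  suc k * (suc n C suc k) ≡⟨ cong (suc k *_) (k>n⇒nCk≡0 (s<s n<k)) ⟩
  suc k * 0               ≡⟨ *-zeroʳ (suc k) ⟩
  0                       ≡⟨ *-zeroʳ (suc n) ⟨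
  suc n * 0               ≡⟨ cong (suc n *_) (k>n⇒nCk≡0 n<k) ⟨
  suc n * (n C k)         ∎
  where
  open ≡-Reasoning
  n<k = ≰⇒> k≰n

[k+1]*[m+k]C[k+1]≡m*[m+k]Ck : ∀ m k → suc k * ((m + k) C suc k) ≡ m * ((m + k) C k)
[k+1]*[m+k]C[k+1]≡m*[m+k]Ck m k = +-cancelˡ-≡ (suc k * X) _ _ (begin
  suc k * X + suc k * Y  ≡⟨ *-distribˡ-+ (suc k) X Y ⟨
  suc k * (X + Y)        ≡⟨ cong (suc k *_) (nCk+nC[k+1]≡[n+1]C[k+1] (m + k) k) ⟩
  suc k * (suc (m + k) C suc k) ≡⟨ [k+1]*[n+1]C[k+1]≡[n+1]*nCk (m + k) k ⟩
  suc (m + k) * X        ≡⟨ split m k X ⟩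
  suc k * X + m * X      ∎)
  where
  open ≡-Reasoning
  X = (m + k) C k
  Y = (m + k) C suc k
  split : ∀ m k x → suc (m + k) * x ≡ suc k * x + m * x
  split = solve-∀

n∣k*nCk : ∀ n k → n ∣ k * (n C k)
n∣k*nCk n       zero    = n ∣0
n∣k*nCk zero    (suc k) = subst (0 ∣_) (sym (*-zeroʳ (suc k))) (0 ∣0)
n∣k*nCk (suc n) (suc k) = divides (n C k) (trans ([k+1]*[n+1]C[k+1]≡[n+1]*nCk n k) (*-comm (suc n) (n C k)))

[k+1]∣m*[m+k]Ck : ∀ m k → suc k ∣ m * ((m + k) C k)
[k+1]∣m*[m+k]Ck m k = divides ((m + k) C suc k)
  (trans (sym ([k+1]*[m+k]C[k+1]≡m*[m+k]Ck m k)) (*-comm (suc k) ((m + k) C suc k)))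

n∣[n∸k]*nCk : ∀ n k → n ∣ (n ∸ k) * (n C k)
n∣[n∸k]*nCk n k with k ≤? n
... | no k≰n rewrite m≤n⇒m∸n≡0 (<⇒≤ (≰⇒> k≰n)) = n ∣0
... | yes k≤n = subst (λ x → x ∣ (n ∸ k) * (x C k)) (m∸n+n≡m k≤n) (u+k∣u*[u+k]Ck (n ∸ k))
  where
  u+k∣u*[u+k]Ck : ∀ u → u + k ∣ u * ((u + k) C k)
  u+k∣u*[u+k]Ck zero    = k ∣0
  u+k∣u*[u+k]Ck (suc r) = divides ((r + k) C k) (begin
    suc r * ((suc r + k) C k)     ≡⟨ [k+1]*[m+k]C[k+1]≡m*[m+k]Ck (suc r) k ⟨
    suc k * (suc (r + k) C suc k) ≡⟨ [k+1]*[n+1]C[k+1]≡[n+1]*nCk (r + k) k ⟩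
    suc (r + k) * ((r + k) C k)   ≡⟨ *-comm (suc (r + k)) ((r + k) C k) ⟩
    ((r + k) C k) * suc (r + k)   ∎)
    where open ≡-Reasoning

2*k≡k+k : ∀ k → 2 * k ≡ k + k
2*k≡k+k k = cong (_+_ k) (+-identityʳ k)

[n+k]C[2k]≡0 : ∀ {n k} → n < k → (n + k) C (2 * k) ≡ 0
[n+k]C[2k]≡0 {n} {k} n<k = k>n⇒nCk≡0 (subst (n + k <_) (sym (2*k≡k+k k)) (+-monoˡ-< k n<k))

[n+k]C[2k]*[2k]Ck≡[n+k]Ck*nCk : ∀ n k → ((n + k) C (2 * k)) * ((2 * k) C k) ≡ ((n + k) C k) * (n C k)
[n+k]C[2k]*[2k]Ck≡[n+k]Ck*nCk n k with k ≤? n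
... | no k≰n rewrite [n+k]C[2k]≡0 (≰⇒> k≰n) | k>n⇒nCk≡0 (≰⇒> k≰n) = sym (*-zeroʳ ((n + k) C k))
... | yes k≤n with u , refl ← m≤n⇒∃[o]m+o≡n k≤n = begin
  ((k + u + k) C (2 * k)) * ((2 * k) C k) ≡⟨ cong₂ (λ a b → (a C b) * (b C k)) k+u+k≡k+k+u (2*k≡k+k k) ⟩
  B (k + k) u * B k k                     ≡⟨ B-trinomial k k u ⟩
  B k (k + u) * B k u                     ≡⟨ cong (λ a → (a C k) * B k u) (+-comm k (k + u)) ⟩
  ((k + u + k) C k) * ((k + u) C k)       ∎
  where
  open ≡-Reasoning
  k+u+k≡k+k+u = trans (+-comm (k + u) k) (sym (+-assoc k k u))

-- a divides gcd (n * a) (n * m) = gcd a m * n.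
∣m*n⇒gcd∣o⇒∣n*o : ∀ {a m n o} → a ∣ m * n → gcd a m ∣ o → a ∣ n * o
∣m*n⇒gcd∣o⇒∣n*o {a} {m} {n} {o} a∣m*n g∣o = ∣-trans a∣g*n (subst (gcd a m * n ∣_) (*-comm o n) (*-monoˡ-∣ n g∣o))
  where
  a∣g*n : a ∣ gcd a m * n
  a∣g*n = subst (a ∣_) (trans (sym (c*gcd[m,n]≡gcd[cm,cn] n a m)) (*-comm n (gcd a m)))
            (gcd-greatest (n∣m*n n) (subst (a ∣_) (*-comm m n) a∣m*n))

∣[k+1]⇒∣j⇒coprime[k+j] : ∀ {d k j} → d ∣ suc k → d ∣ j → Coprime d (k + j)
∣[k+1]⇒∣j⇒coprime[k+j] {d} {k} {j} d∣k+1 d∣j {i} (i∣d , i∣k+j) = ∣1⇒≡1 (∣m+n∣m⇒∣n i∣k+j+1 i∣k+j)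
  where
  i∣k+j+1 = subst (i ∣_) (+-comm 1 (k + j)) (∣m∣n⇒∣m+n (∣-trans i∣d d∣k+1) (∣-trans i∣d d∣j))

[k+1]∣[m+k]Ck*[mCj*[m+j]C[k+j]] : ∀ j k m → suc k ∣ ((m + k) C k) * ((m C j) * ((m + j) C (k + j)))
[k+1]∣[m+k]Ck*[mCj*[m+j]C[k+j]] j k m = ∣m*n⇒gcd∣o⇒∣n*o {m = m} ([k+1]∣m*[m+k]Ck m k) g∣o
  where
  g = gcd (suc k) m
  d = gcd g j
  d∣k+1 = ∣-trans (gcd[m,n]∣m g j) (gcd[m,n]∣m (suc k) m)
  d∣m   = ∣-trans (gcd[m,n]∣m g j) (gcd[m,n]∣n (suc k) m)
  d∣j   = gcd[m,n]∣n g j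
  d∣[m+j]C[k+j] : d ∣ (m + j) C (k + j)
  d∣[m+j]C[k+j] = coprime-divisor (∣[k+1]⇒∣j⇒coprime[k+j] d∣k+1 d∣j)
                    (∣-trans (∣m∣n⇒∣m+n d∣m d∣j) (n∣k*nCk (m + j) (k + j)))
  g∣o : g ∣ (m C j) * ((m + j) C (k + j))
  g∣o = ∣m*n⇒gcd∣o⇒∣n*o {m = j} (∣-trans (gcd[m,n]∣n (suc k) m) (n∣k*nCk m j)) d∣[m+j]C[k+j]

[2k]C[j+k]*[m+k]C[2k]*[m+j]Cj≡kCj*[[m+k]Ck*[m+j]C[k+j]] : ∀ j k m →
  ((2 * k) C (j + k)) * ((m + k) C (2 * k)) * ((m + j) C j) ≡ (k C j) * (((m + k) C k) * ((m + j) C (k + j)))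
[2k]C[j+k]*[m+k]C[2k]*[m+j]Cj≡kCj*[[m+k]Ck*[m+j]C[k+j]] j k m with j ≤? k | k ≤? m
... | no j≰k | _
  rewrite k>n⇒nCk≡0 (subst (_< j + k) (sym (2*k≡k+k k)) (+-monoˡ-< k (≰⇒> j≰k))) | k>n⇒nCk≡0 (≰⇒> j≰k) = refl
... | yes _ | no k≰m rewrite [n+k]C[2k]≡0 (≰⇒> k≰m) | k>n⇒nCk≡0 (+-monoˡ-< j (≰⇒> k≰m)) =
  trans (cong (_* ((m + j) C j)) (*-zeroʳ ((2 * k) C (j + k))))
        (sym (trans (cong ((k C j) *_) (*-zeroʳ ((m + k) C k))) (*-zeroʳ (k C j))))
... | yes j≤k | yes k≤m with t , refl ← m≤n⇒∃[o]m+o≡n j≤k with s , refl ← m≤n⇒∃[o]m+o≡n k≤m = begin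
  ((2 * k) C (j + k)) * ((m + k) C (2 * k)) * ((m + j) C j)
    ≡⟨ cong₂ (λ x y → (x C (j + k)) * (y C (2 * k)) * ((m + j) C j)) (2k≡j+k+t j t) (m+k≡2k+s j t s) ⟩
  B (j + k) t * B (2 * k) s * ((m + j) C j)  ≡⟨ cong (λ x → B (j + k) t * B (2 * k) s * (x C j)) (+-comm m j) ⟩
  B (j + k) t * B (2 * k) s * B j m          ≡⟨ cong (_* B j m) (*-comm (B (j + k) t) (B (2 * k) s)) ⟩
  B (2 * k) s * B (j + k) t * B j m          ≡⟨ cong (λ x → B x s * B (j + k) t * B j m) (2k≡j+k+t j t) ⟩
  B (j + k + t) s * B (j + k) t * B j m      ≡⟨ cong (_* B j m) (B-trinomial (j + k) t s) ⟩
  B (j + k) (t + s) * B t s * B j m          ≡⟨ cong (λ x → x * B t s * B j m) (B-sym (j + k) (t + s)) ⟩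
  B (t + s) (j + k) * B t s * B j m          ≡⟨ cong (_* B j m) (B-trinomial t s (j + k)) ⟩
  B t (s + (j + k)) * B s (j + k) * B j m    ≡⟨ cong₂ (λ x y → B t x * y * B j m) (s+[j+k]≡j+m j t s) (B-sym s (j + k)) ⟩
  B t (j + m) * B (j + k) s * B j m          ≡⟨ xy∙z≈xz∙y (B t (j + m)) (B (j + k) s) (B j m) ⟩
  B t (j + m) * B j m * B (j + k) s          ≡⟨ cong (_* B (j + k) s) (B-trinomial t j m) ⟨
  B (t + j) m * B t j * B (j + k) s          ≡⟨ cong₂ (λ x y → B x m * y * B (j + k) s) (+-comm t j) (B-sym t j) ⟩
  B k m * B j t * B (j + k) s                ≡⟨ cong (λ x → B k m * B j t * B x s) (+-comm j k) ⟩
  B k m * B j t * B (k + j) s                ≡⟨ xy∙z≈y∙xz (B k m) (B j t) (B (k + j) s) ⟩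
  B j t * (B k m * B (k + j) s)              ≡⟨ cong₂ (λ x y → B j t * ((x C k) * (y C (k + j)))) (+-comm k m) (k+j+s≡m+j j t s) ⟩
  (k C j) * (((m + k) C k) * ((m + j) C (k + j))) ∎
  where
  open ≡-Reasoning
  2k≡j+k+t : ∀ j t → 2 * (j + t) ≡ j + (j + t) + t
  2k≡j+k+t = solve-∀
  m+k≡2k+s : ∀ j t s → j + t + s + (j + t) ≡ 2 * (j + t) + s
  m+k≡2k+s = solve-∀
  s+[j+k]≡j+m : ∀ j t s → s + (j + (j + t)) ≡ j + (j + t + s)
  s+[j+k]≡j+m = solve-∀
  k+j+s≡m+j : ∀ j t s → j + t + j + s ≡ j + t + s + j
  k+j+s≡m+j = solve-∀

[k+1]∣m*[m+1]*[m+k]C[2k] : ∀ m k → suc k ∣ m * suc m * ((m + k) C (2 * k))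
[k+1]∣m*[m+1]*[m+k]C[2k] m k with k ≤? m
... | no k≰m rewrite [n+k]C[2k]≡0 (≰⇒> k≰m) = subst (suc k ∣_) (sym (*-zeroʳ (m * suc m))) (suc k ∣0)
... | yes k≤m = subst (λ x → suc k ∣ x * suc x * ((x + k) C (2 * k))) (m∸n+n≡m k≤m) ([k+1]∣[s+k]*[s+k+1]*C (m ∸ k))
  where
  [k+1]∣[s+k]*[s+k+1]*C : ∀ s → suc k ∣ (s + k) * suc (s + k) * ((s + k + k) C (2 * k))
  [k+1]∣[s+k]*[s+k+1]*C s = subst (suc k ∣_) (sym split) (∣m∣n⇒∣m+n (∣n⇒∣m*n (suc (2 * k)) [k+1]∣s*D) (∣m⇒∣m*n c (n∣m*n k)))
    where
    open ≡-Reasoning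
    c = (s + k + k) C (2 * k)
    D = suc (s + 2 * k) C suc (2 * k)
    E = (s + suc (2 * k)) C suc (suc (2 * k))
    [k+1]∣s*D : suc k ∣ s * D
    [k+1]∣s*D = divides (2 * E) (begin
      s * D                                     ≡⟨ cong (λ x → s * (x C suc (2 * k))) (+-suc s (2 * k)) ⟨
      s * ((s + suc (2 * k)) C suc (2 * k))     ≡⟨ [k+1]*[m+k]C[k+1]≡m*[m+k]Ck s (suc (2 * k)) ⟨
      suc (suc (2 * k)) * E                     ≡⟨ double k E ⟩
      2 * E * suc k                             ∎)
      where
      double : ∀ k e → suc (suc (2 * k)) * e ≡ 2 * e * suc k
      double = solve-∀
    split : (s + k) * suc (s + k) * c ≡ suc (2 * k) * (s * D) + k * suc k * c
    split = begin
      (s + k) * suc (s + k) * c               ≡⟨ expand s k c ⟩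
      s * (suc (s + 2 * k) * c) + k * suc k * c
        ≡⟨ cong (λ x → s * (suc (s + 2 * k) * (x C (2 * k))) + k * suc k * c) s+k+k≡s+2k ⟩
      s * (suc (s + 2 * k) * ((s + 2 * k) C (2 * k))) + k * suc k * c
        ≡⟨ cong (λ x → s * x + k * suc k * c) ([k+1]*[n+1]C[k+1]≡[n+1]*nCk (s + 2 * k) (2 * k)) ⟨
      s * (suc (2 * k) * D) + k * suc k * c   ≡⟨ cong (_+ k * suc k * c) (x∙yz≈y∙xz s (suc (2 * k)) D) ⟩
      suc (2 * k) * (s * D) + k * suc k * c   ∎
      where
      s+k+k≡s+2k = trans (+-assoc s k k) (cong (_+_ s) (sym (2*k≡k+k k)))
      expand : ∀ s k c → (s + k) * suc (s + k) * c ≡ s * (suc (s + 2 * k) * c) + k * suc k * c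
      expand = solve-∀

[2k]Ck∣[k+1]*[m+1]C[k+1]*[m+k]C[k+1] : ∀ m k → (2 * k) C k ∣ suc k * (suc m C suc k) * ((m + k) C suc k)
[2k]Ck∣[k+1]*[m+1]C[k+1]*[m+k]C[k+1] m k with divides W eqW ← [k+1]∣m*[m+1]*[m+k]C[2k] m k =
  divides W (*-cancelˡ-≡ _ _ (suc k) (begin
    suc k * (suc k * P * Q)                       ≡⟨ square (suc k) P Q ⟩
    (suc k * P) * (suc k * Q)                     ≡⟨ cong₂ _*_ ([k+1]*[n+1]C[k+1]≡[n+1]*nCk m k) ([k+1]*[m+k]C[k+1]≡m*[m+k]Ck m k) ⟩
    (suc m * (m C k)) * (m * ((m + k) C k))       ≡⟨ regroup (suc m) (m C k) m ((m + k) C k) ⟩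
    m * suc m * (((m + k) C k) * (m C k))         ≡⟨ cong (m * suc m *_) ([n+k]C[2k]*[2k]Ck≡[n+k]Ck*nCk m k) ⟨
    m * suc m * (((m + k) C (2 * k)) * ((2 * k) C k)) ≡⟨ *-assoc (m * suc m) ((m + k) C (2 * k)) ((2 * k) C k) ⟨
    m * suc m * ((m + k) C (2 * k)) * ((2 * k) C k)   ≡⟨ cong (_* ((2 * k) C k)) eqW ⟩
    W * suc k * ((2 * k) C k)                     ≡⟨ xy∙z≈y∙xz W (suc k) ((2 * k) C k) ⟩
    suc k * (W * ((2 * k) C k))                   ∎))
  where
  open ≡-Reasoning
  P = suc m C suc k
  Q = (m + k) C suc k
  square : ∀ a p q → a * (a * p * q) ≡ (a * p) * (a * q)
  square = solve-∀
  regroup : ∀ a b c d → (a * b) * (c * d) ≡ c * a * (d * b)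
  regroup = solve-∀

n∣[n∸k]*[n+k]C[2k]*[2k]Ck : ∀ n k → n ∣ (n ∸ k) * ((n + k) C (2 * k)) * ((2 * k) C k)
n∣[n∸k]*[n+k]C[2k]*[2k]Ck n k = subst (n ∣_) eq (∣m⇒∣m*n ((n + k) C k) (n∣[n∸k]*nCk n k))
  where
  open ≡-Reasoning
  eq : (n ∸ k) * (n C k) * ((n + k) C k) ≡ (n ∸ k) * ((n + k) C (2 * k)) * ((2 * k) C k)
  eq = begin
    (n ∸ k) * (n C k) * ((n + k) C k)                 ≡⟨ xy∙z≈x∙zy (n ∸ k) (n C k) ((n + k) C k) ⟩
    (n ∸ k) * (((n + k) C k) * (n C k))               ≡⟨ cong ((n ∸ k) *_) ([n+k]C[2k]*[2k]Ck≡[n+k]Ck*nCk n k) ⟨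
    (n ∸ k) * (((n + k) C (2 * k)) * ((2 * k) C k))   ≡⟨ *-assoc (n ∸ k) ((n + k) C (2 * k)) ((2 * k) C k) ⟨
    (n ∸ k) * ((n + k) C (2 * k)) * ((2 * k) C k)     ∎

first-expression-integral : ∀ m n k →
  (+ n) ∣ℤ ((+ n - + k) *ℤ (+ ((k + 1) * ((n + k) C (2 * k)) * ((m + 1) C (k + 1)) * ((m + k) C (k + 1)))))
first-expression-integral m n k with k ≤? n
... | no k≰n rewrite [n+k]C[2k]≡0 (≰⇒> k≰n) | *-zeroʳ (k + 1) | ℤ.*-zeroʳ (+ n - + k) = n ∣0
... | yes k≤n = subst (n ∣_) (sym (trans (ℤ.abs-* (+ n - + k) (+ X)) (cong (_* X) ∣n-k∣≡n∸k))) n∣[n∸k]*X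
  where
  X = (k + 1) * ((n + k) C (2 * k)) * ((m + 1) C (k + 1)) * ((m + k) C (k + 1))
  ∣n-k∣≡n∸k : ∣ + n - + k ∣ ≡ n ∸ k
  ∣n-k∣≡n∸k = cong ∣_∣ (trans (ℤ.[+m]-[+n]≡m⊖n n k) (ℤ.⊖-≥ k≤n))
  n∣[n∸k]*X : n ∣ (n ∸ k) * X
  n∣[n∸k]*X rewrite +-comm k 1 | +-comm m 1 =
    subst (n ∣_) (regroup (n ∸ k) ((n + k) C (2 * k)) (suc k) (suc m C suc k) ((m + k) C suc k))
      (∣-trans (n∣[n∸k]*[n+k]C[2k]*[2k]Ck n k)
               (*-monoʳ-∣ ((n ∸ k) * ((n + k) C (2 * k))) ([2k]Ck∣[k+1]*[m+1]C[k+1]*[m+k]C[k+1] m k)))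
    where
    regroup : ∀ a b c d e → a * b * (c * d * e) ≡ a * (c * b * d * e)
    regroup = solve-∀

second-expression-integral : ∀ m n j k →
  (k + 1) ∣ (((n ∸ 1) C k) * ((n + k) C k) * ((2 * k) C (j + k)) * ((m + k) C (2 * k)) * (m C j) * ((m + j) C j))
second-expression-integral m n j k =
  subst₂ _∣_ (+-comm 1 k) eq (∣n⇒∣m*n (a * b * (k C j)) ([k+1]∣[m+k]Ck*[mCj*[m+j]C[k+j]] j k m))
  where
  open ≡-Reasoning
  a = (n ∸ 1) C k
  b = (n + k) C k
  eq : a * b * (k C j) * (((m + k) C k) * ((m C j) * ((m + j) C (k + j))))
     ≡ a * b * ((2 * k) C (j + k)) * ((m + k) C (2 * k)) * (m C j) * ((m + j) C j)
  eq = begin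
    a * b * (k C j) * (((m + k) C k) * ((m C j) * ((m + j) C (k + j))))
      ≡⟨ pull (m C j) a b (k C j) ((m + k) C k) ((m + j) C (k + j)) ⟩
    a * b * ((k C j) * (((m + k) C k) * ((m + j) C (k + j)))) * (m C j)
      ≡⟨ cong (λ x → a * b * x * (m C j)) ([2k]C[j+k]*[m+k]C[2k]*[m+j]Cj≡kCj*[[m+k]Ck*[m+j]C[k+j]] j k m) ⟨
    a * b * (((2 * k) C (j + k)) * ((m + k) C (2 * k)) * ((m + j) C j)) * (m C j)
      ≡⟨ push (m C j) a b ((2 * k) C (j + k)) ((m + k) C (2 * k)) ((m + j) C j) ⟩
    a * b * ((2 * k) C (j + k)) * ((m + k) C (2 * k)) * (m C j) * ((m + j) C j) ∎
    where
    pull : ∀ e a b c x z → a * b * c * (x * (e * z)) ≡ a * b * (c * (x * z)) * e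
    pull = solve-∀
    push : ∀ e a b c d f → a * b * (c * d * f) * e ≡ a * b * c * d * e * f
    push = solve-∀

theorem1p2 : (m n j k : ℕ) → 1 ≤ m → 1 ≤ n →
    ((+ n) ∣ℤ ((+ n - + k) *ℤ (+ ((k + 1) * ((n + k) C (2 * k)) * ((m + 1) C (k + 1)) * ((m + k) C (k + 1))))))
    × ((k + 1) ∣ (((n ∸ 1) C k) * ((n + k) C k) * ((2 * k) C (j + k)) * ((m + k) C (2 * k)) * (m C j) * ((m + j) C j)))
theorem1p2 m n j k _ _ = first-expression-integral m n k , second-expression-integral m n j k
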